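{- Let $f\colon\mathbb{N}_0\to\mathbb{N}_0$ be a multiplicative arithmetic function (i.e. $f(1)=1$ and $f(mn)=f(m)f(n)$ for coprime $m,n\in\mathbb{N}$) such that for all primes $p$ and positive integers $\alpha$: (I) $f(p^{\alpha})<p^{\alpha}$; (II) $f(p)\mid f(p^{\alpha})$; (III) every prime $q$ dividing $f(p^{\alpha})$ divides $p\,f(p)$; and (IV) $f(0)=0$. Define $H$ and $S$ as below. Then for every positive integer $k$, $H(k)=1$ if and only if $k\in S$.
   Context: $f^0(n)=n$, $f^{k+1}(n)=f(f^k(n))$. For $n\in\mathbb{N}$, $H(n)=\lim_{m\to\infty}f^m(n)$ (this limit exists and equals $f^n(n)\in\{0,1\}$). $Q=\{q \text{ prime}: H(q)=0\}$ and $S=\{n\in\mathbb{N}: q\nmid n \text{ for all } q\in Q\}$. -}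

module Defs where

open import Data.Nat using (ℕ; zero; suc; _*_; _^_; _<_; _≤_; _≥_)
open import Data.Nat.Divisibility using (_∣_)
open import Data.Nat.Primality using (Prime)
open import Data.Nat.Coprimality using (Coprime)
open import Data.Product using (_×_; ∃-syntax)
open import Relation.Binary.PropositionalEquality using (_≡_)
open import Relation.Nullary using (¬_)

iter : (ℕ → ℕ) → ℕ → ℕ → ℕ
iter f zero    n = n
iter f (suc k) n = f (iter f k n)

-- "H(n) = v", i.e. lim_{m→∞} f^m(n) = v (a ℕ-valued sequence converges
-- iff it is eventually constant)
HasLimit : (ℕ → ℕ) → ℕ → ℕ → Set
HasLimit f n v = ∃[ M ] (∀ m → m ≥ M → iter f m n ≡ v)

InQ : (ℕ → ℕ) → ℕ → Set
InQ f q = Prime q × HasLimit f q 0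

InS : (ℕ → ℕ) → ℕ → Set
InS f n = ∀ q → InQ f q → ¬ (q ∣ n)

Multiplicative : (ℕ → ℕ) → Set
Multiplicative f = (f 1 ≡ 1) ×
  (∀ m n → 1 ≤ m → 1 ≤ n → Coprime m n → f (m * n) ≡ f m * f n)

module Submission where

open import Defs
open import Data.Nat
  using (ℕ; zero; suc; _+_; _*_; _^_; _<_; _≤_; z≤n; s≤s; >-nonZero; >-nonZero⁻¹; nonTrivial⇒n>1)
open import Data.Nat.Properties
open import Data.Nat.Divisibility
open import Data.Nat.Primality
open import Data.Nat.Primality.Factorisation using (factorise)
open import Data.Nat.Coprimality using (Coprime)
open import Data.Nat.ListAction using (product)
open import Data.Nat.Induction using (<-rec)
open import Data.List using ([]; _∷_)
open import Data.List.Relation.Unary.All using (_∷_)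
open import Data.Product using (_×_; _,_; proj₁; proj₂; ∃-syntax)
open import Data.Sum using (_⊎_; inj₁; inj₂)
open import Data.Empty using (⊥-elim)
open import Function.Base using (_∘_)
open import Function.Bundles using (_⇔_; mk⇔; Equivalence)
import Function.Properties.Equivalence as ⇔
open import Relation.Binary.PropositionalEquality
open import Relation.Nullary using (¬_; yes; no)

prime>1 : ∀ {p} → Prime p → 1 < p
prime>1 {p} pp = nonTrivial⇒n>1 p {{prime⇒nonTrivial pp}}

prime∤1 : ∀ {p} → Prime p → ¬ (p ∣ 1)
prime∤1 pp p∣1 = ¬prime[1] (subst Prime (∣1⇒≡1 p∣1) pp)

prime-divisor : ∀ n → 2 ≤ n → ∃[ p ] (Prime p × p ∣ n)
prime-divisor (suc zero) (s≤s ())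
prime-divisor n@(suc (suc _)) _ with factorise n
... | record { factors = [] ; isFactorisation = () }
... | record { factors = p ∷ ps ; isFactorisation = eq ; factorsPrime = pp ∷ _ } =
  p , pp , divides (product ps) (trans eq (*-comm p _))

-- Every positive n has a prime that does not divide it: one dividing n + 1.
prime-nondivisor : ∀ n → 1 ≤ n → ∃[ q ] (Prime q × ¬ (q ∣ n))
prime-nondivisor n 1≤n with prime-divisor (suc n) (s≤s 1≤n)
... | q , qp , q∣1+n =
  q , qp , λ q∣n → prime∤1 qp (∣m+n∣m⇒∣n (subst (q ∣_) (+-comm 1 n) q∣1+n) q∣n)

∣pow : ∀ p a → 1 ≤ a → p ∣ p ^ a
∣pow p (suc a) _ = m∣m*n (p ^ a)

prime∣prime⇒≡ : ∀ {r p} → Prime r → Prime p → r ∣ p → r ≡ p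
prime∣prime⇒≡ rp pp r∣p with prime⇒irreducible pp r∣p
... | inj₁ refl = ⊥-elim (¬prime[1] rp)
... | inj₂ r≡p  = r≡p

prime∣pow⇒≡ : ∀ {r p} a → Prime r → Prime p → r ∣ p ^ a → r ≡ p
prime∣pow⇒≡ zero    rp pp r∣1 = ⊥-elim (prime∤1 rp r∣1)
prime∣pow⇒≡ {p = p} (suc a) rp pp r∣pᵃ⁺¹ with euclidsLemma p (p ^ a) rp r∣pᵃ⁺¹
... | inj₁ r∣p  = prime∣prime⇒≡ rp pp r∣p
... | inj₂ r∣pᵃ = prime∣pow⇒≡ a rp pp r∣pᵃ

-- If the prime p does not divide m, then pᵃ and m are coprime:
-- a common divisor > 1 would have a prime factor, which must be p.
coprime-pow : ∀ {p m} a → Prime p → ¬ (p ∣ m) → Coprime (p ^ a) m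
coprime-pow a pp p∤m {zero} (_ , 0∣m) = ⊥-elim (p∤m (subst (_ ∣_) (sym (0∣⇒≡0 0∣m)) (_ ∣0)))
coprime-pow a pp p∤m {suc zero} _ = refl
coprime-pow a pp p∤m {d@(suc (suc _))} (d∣pᵃ , d∣m) with prime-divisor d (s≤s (s≤s z≤n))
... | r , rp , r∣d with prime∣pow⇒≡ a rp pp (∣-trans r∣d d∣pᵃ)
... | refl = ⊥-elim (p∤m (∣-trans r∣d d∣m))

p-adic-split : ∀ {p} → Prime p → ∀ n → 1 ≤ n → ∃[ a ] ∃[ m ] (n ≡ p ^ a * m × ¬ (p ∣ m))
p-adic-split {p} pp = <-rec Split split
  where
  Split : ℕ → Set
  Split n = 1 ≤ n → ∃[ a ] ∃[ m ] (n ≡ p ^ a * m × ¬ (p ∣ m))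
  instance _ = prime⇒nonTrivial pp
  split : ∀ n → (∀ {k} → k < n → Split k) → Split n
  split n rec 1≤n with p ∣? n
  ... | no p∤n = 0 , n , sym (+-identityʳ n) , p∤n
  ... | yes p∣n with rec (quotient-< p∣n) (>-nonZero⁻¹ _ {{quotient≢0 p∣n}})
    where instance _ = >-nonZero 1≤n
  ...   | a , m , q≡pᵃm , p∤m = suc a , m , n≡pᵃ⁺¹m , p∤m
    where
    n≡pᵃ⁺¹m : n ≡ p ^ suc a * m
    n≡pᵃ⁺¹m = begin
      n                  ≡⟨ m∣n⇒n≡m*quotient p∣n ⟩
      p * quotient p∣n   ≡⟨ cong (p *_) q≡pᵃm ⟩
      p * (p ^ a * m)    ≡⟨ *-assoc p (p ^ a) m ⟨
      p ^ suc a * m      ∎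
      where open ≡-Reasoning

prime-power-peel : ∀ n → 2 ≤ n →
  ∃[ p ] ∃[ a ] ∃[ m ] (Prime p × 1 ≤ a × 1 ≤ m × n ≡ p ^ a * m × Coprime (p ^ a) m × m < n)
prime-power-peel n 2≤n with prime-divisor n 2≤n
... | p , pp , p∣n with p-adic-split pp n (≤-trans (s≤s z≤n) 2≤n)
... | zero , m , n≡m , p∤m = ⊥-elim (p∤m (subst (p ∣_) (trans n≡m (*-identityˡ m)) p∣n))
... | suc a , zero , n≡0 , _ =
  ⊥-elim (<⇒≱ 2≤n (≤-trans (≤-reflexive (trans n≡0 (*-zeroʳ (p ^ suc a)))) z≤n))
... | suc a , m@(suc _) , n≡pᵃm , p∤m =
  p , suc a , m , pp , s≤s z≤n , s≤s z≤n , n≡pᵃm , coprime-pow (suc a) pp p∤m , m<n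
  where
  m<n : m < n
  m<n = ≤-trans (m<m*n m (p ^ suc a) (^-monoʳ-< p (prime>1 pp) {0} {suc a} (s≤s z≤n)))
                (≤-reflexive (trans (*-comm m (p ^ suc a)) (sym n≡pᵃm)))

CoprimePowerStep : (ℕ → Set) → Set
CoprimePowerStep P = ∀ p a m → Prime p → 1 ≤ a → 1 ≤ m → Coprime (p ^ a) m → P m → P (p ^ a * m)

prime-power-induction : (P : ℕ → Set) → P 1 → CoprimePowerStep P → ∀ n → 1 ≤ n → P n
prime-power-induction P base step = <-rec (λ n → 1 ≤ n → P n) go
  where
  go : ∀ n → (∀ {k} → k < n → 1 ≤ k → P k) → 1 ≤ n → P n
  go (suc zero) _ _ = base
  go n@(suc (suc _)) rec _ with prime-power-peel n (s≤s (s≤s z≤n))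
  ... | p , a , m , pp , 1≤a , 1≤m , n≡pᵃm , coprime , m<n =
    subst P (sym n≡pᵃm) (step p a m pp 1≤a 1≤m coprime (rec m<n 1≤m))

module Iterates (g : ℕ → ℕ) where

  iter-suc : ∀ m x → iter g (suc m) x ≡ iter g m (g x)
  iter-suc zero    x = refl
  iter-suc (suc m) x = cong g (iter-suc m x)

  -- A limit of an orbit is unique: compare both at a common late index.
  limit-unique : ∀ {x u v} → HasLimit g x u → HasLimit g x v → u ≡ v
  limit-unique (M , lim-u) (N , lim-v) =
    trans (sym (lim-u (M + N) (m≤m+n M N))) (lim-v (M + N) (m≤n+m N M))

  -- The orbit of x is the orbit of g x with one extra first term.
  limit-shift : ∀ {x v} → HasLimit g (g x) v ⇔ HasLimit g x v
  limit-shift {x} {v} = mk⇔ forward backward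
    where
    forward : HasLimit g (g x) v → HasLimit g x v
    forward (M , lim) = suc M , λ where
      (suc m) (s≤s M≤m) → trans (iter-suc m x) (lim m M≤m)
    backward : HasLimit g x v → HasLimit g (g x) v
    backward (M , lim) = M , λ m M≤m → trans (sym (iter-suc m x)) (lim (suc m) (m≤n⇒m≤1+n M≤m))

  fixed-point-limit : ∀ {x} → g x ≡ x → HasLimit g x x
  fixed-point-limit {x} gx≡x = 0 , λ m _ → iter-fixed m
    where
    iter-fixed : ∀ m → iter g m x ≡ x
    iter-fixed zero    = refl
    iter-fixed (suc m) = trans (cong g (iter-fixed m)) gx≡x

  limit-exists : g 0 ≡ 0 → g 1 ≡ 1 → (∀ n → 2 ≤ n → g n < n)
    → ∀ n → HasLimit g n 0 ⊎ HasLimit g n 1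
  limit-exists g0 g1 decreasing = <-rec _ go
    where
    go : ∀ n → (∀ {k} → k < n → HasLimit g k 0 ⊎ HasLimit g k 1) → HasLimit g n 0 ⊎ HasLimit g n 1
    go zero          _   = inj₁ (fixed-point-limit g0)
    go (suc zero)    _   = inj₂ (fixed-point-limit g1)
    go n@(suc (suc _)) rec with rec (decreasing n (s≤s (s≤s z≤n)))
    ... | inj₁ lim = inj₁ (Equivalence.to limit-shift lim)
    ... | inj₂ lim = inj₂ (Equivalence.to limit-shift lim)

module Conditions (f : ℕ → ℕ) (multiplicative : Multiplicative f)
  (pow-shrinks : ∀ p α → Prime p → 1 ≤ α → f (p ^ α) < p ^ α)
  (prime∣pow   : ∀ p α → Prime p → 1 ≤ α → f p ∣ f (p ^ α))
  (support     : ∀ p α q → Prime p → 1 ≤ α → Prime q → q ∣ f (p ^ α) → q ∣ p * f p)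
  (f0≡0        : f 0 ≡ 0) where

  open Iterates f

  f1≡1 : f 1 ≡ 1
  f1≡1 = proj₁ multiplicative

  f-coprime : ∀ p a m → Prime p → 1 ≤ m → Coprime (p ^ a) m → f (p ^ a * m) ≡ f (p ^ a) * f m
  f-coprime p a m pp 1≤m coprime =
    proj₂ multiplicative (p ^ a) m (m^n>0 p {{prime⇒nonZero pp}} a) 1≤m coprime

  -- Every n ≥ 1 is 1 or strictly shrinks: f(pᵃm) = f(pᵃ) f(m) ≤ f(pᵃ) m < pᵃ m.
  shrinks : ∀ n → 1 ≤ n → n ≡ 1 ⊎ f n < n
  shrinks = prime-power-induction (λ n → n ≡ 1 ⊎ f n < n) (inj₁ refl) step
    where
    f≤ : ∀ {m} → m ≡ 1 ⊎ f m < m → f m ≤ m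
    f≤ (inj₁ refl) = ≤-reflexive f1≡1
    f≤ (inj₂ fm<m) = <⇒≤ fm<m
    step : CoprimePowerStep (λ n → n ≡ 1 ⊎ f n < n)
    step p a m pp 1≤a 1≤m coprime ih = inj₂ (begin-strict
      f (p ^ a * m)    ≡⟨ f-coprime p a m pp 1≤m coprime ⟩
      f (p ^ a) * f m  ≤⟨ *-monoʳ-≤ (f (p ^ a)) (f≤ ih) ⟩
      f (p ^ a) * m    <⟨ *-monoˡ-< m {{>-nonZero 1≤m}} (pow-shrinks p a pp 1≤a) ⟩
      p ^ a * m        ∎)
      where open ≤-Reasoning

  f-decreasing : ∀ n → 2 ≤ n → f n < n
  f-decreasing n 2≤n with shrinks n (<⇒≤ 2≤n)
  ... | inj₁ refl = ⊥-elim (<-irrefl refl 2≤n)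
  ... | inj₂ fn<n = fn<n

  -- By (III), f(pᵃ) = 0 would make every prime divide p·f(p); this is only
  -- possible if f(p) = 0.
  f-pow-zero : ∀ p a → Prime p → 1 ≤ a → f (p ^ a) ≡ 0 → f p ≡ 0
  f-pow-zero p a pp 1≤a fpᵃ≡0 with f p in fp≡
  ... | zero  = refl
  ... | suc k with prime-nondivisor (p * suc k) (*-mono-≤ (<⇒≤ (prime>1 pp)) (s≤s (z≤n {k})))
  ...   | q , qp , q∤pfp = ⊥-elim (q∤pfp (subst (λ y → q ∣ p * y) fp≡ q∣pfp))
    where
    q∣pfp : q ∣ p * f p
    q∣pfp = support p a q pp 1≤a qp (subst (q ∣_) (sym fpᵃ≡0) (q ∣0))

  zero-at-prime : ∀ n → 1 ≤ n → f n ≡ 0 → ∃[ p ] (Prime p × p ∣ n × f p ≡ 0)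
  zero-at-prime = prime-power-induction P (λ f1≡0 → ⊥-elim (1+n≢0 (trans (sym f1≡1) f1≡0))) step
    where
    P : ℕ → Set
    P n = f n ≡ 0 → ∃[ p ] (Prime p × p ∣ n × f p ≡ 0)
    step : CoprimePowerStep P
    step p a m pp 1≤a 1≤m coprime ih fn≡0
      with m*n≡0⇒m≡0∨n≡0 (f (p ^ a)) (trans (sym (f-coprime p a m pp 1≤m coprime)) fn≡0)
    ... | inj₁ fpᵃ≡0 = p , pp , ∣m⇒∣m*n m (∣pow p a 1≤a) , f-pow-zero p a pp 1≤a fpᵃ≡0
    ... | inj₂ fm≡0 with ih fm≡0
    ...   | r , rp , r∣m , fr≡0 = r , rp , ∣n⇒∣m*n (p ^ a) r∣m , fr≡0

  image-divides : ∀ n → 1 ≤ n → ∀ r → Prime r → r ∣ n → f r ∣ f n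
  image-divides = prime-power-induction P (λ r rp r∣1 → ⊥-elim (prime∤1 rp r∣1)) step
    where
    P : ℕ → Set
    P n = ∀ r → Prime r → r ∣ n → f r ∣ f n
    step : CoprimePowerStep P
    step p a m pp 1≤a 1≤m coprime ih r rp r∣n
      rewrite f-coprime p a m pp 1≤m coprime with euclidsLemma (p ^ a) m rp r∣n
    ... | inj₁ r∣pᵃ with prime∣pow⇒≡ a rp pp r∣pᵃ
    ...   | refl = ∣m⇒∣m*n (f m) (prime∣pow r a pp 1≤a)
    step p a m pp 1≤a 1≤m coprime ih r rp r∣n | inj₂ r∣m = ∣n⇒∣m*n (f (p ^ a)) (ih r rp r∣m)

  image-prime-divisor : ∀ n → 1 ≤ n → ∀ q → Prime q → q ∣ f n
    → ∃[ p ] (Prime p × p ∣ n × (q ≡ p ⊎ q ∣ f p))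
  image-prime-divisor =
    prime-power-induction P (λ q qp q∣f1 → ⊥-elim (prime∤1 qp (subst (q ∣_) f1≡1 q∣f1))) step
    where
    P : ℕ → Set
    P n = ∀ q → Prime q → q ∣ f n → ∃[ p ] (Prime p × p ∣ n × (q ≡ p ⊎ q ∣ f p))
    step : CoprimePowerStep P
    step p a m pp 1≤a 1≤m coprime ih q qp q∣fn
      rewrite f-coprime p a m pp 1≤m coprime with euclidsLemma (f (p ^ a)) (f m) qp q∣fn
    ... | inj₁ q∣fpᵃ =
      p , pp , ∣m⇒∣m*n m (∣pow p a 1≤a) ,
      q≡p⊎q∣fp (euclidsLemma p (f p) qp (support p a q pp 1≤a qp q∣fpᵃ))
      where
      q≡p⊎q∣fp : q ∣ p ⊎ q ∣ f p → q ≡ p ⊎ q ∣ f p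
      q≡p⊎q∣fp (inj₁ q∣p)  = inj₁ (prime∣prime⇒≡ qp pp q∣p)
      q≡p⊎q∣fp (inj₂ q∣fp) = inj₂ q∣fp
    ... | inj₂ q∣fm with ih q qp q∣fm
    ...   | r , rp , r∣m , r-case = r , rp , ∣n⇒∣m*n (p ^ a) r∣m , r-case

  PrimeDivisorsReach1 : ℕ → Set
  PrimeDivisorsReach1 n = ∀ q → Prime q → q ∣ n → HasLimit f q 1

  reach1-∣ : ∀ {d n} → d ∣ n → PrimeDivisorsReach1 n → PrimeDivisorsReach1 d
  reach1-∣ d∣n reach q qp q∣d = reach q qp (∣-trans q∣d d∣n)

  limit-zero : ∀ {x} → f x ≡ 0 → HasLimit f x 0
  limit-zero fx≡0 =
    Equivalence.to limit-shift (subst (λ y → HasLimit f y 0) (sym fx≡0) (fixed-point-limit f0≡0))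

  -- If f n = 0, both sides fail: H(n) = 0, and a prime p ∣ n has f p = 0.
  zero-image : ∀ n → 1 ≤ n → f n ≡ 0 → ¬ HasLimit f n 1 × ¬ PrimeDivisorsReach1 n
  zero-image n 1≤n fn≡0 = (λ lim → 0≢1+n (limit-unique (limit-zero fn≡0) lim)) , ¬reach
    where
    ¬reach : ¬ PrimeDivisorsReach1 n
    ¬reach reach with zero-at-prime n 1≤n fn≡0
    ... | p , pp , p∣n , fp≡0 = 0≢1+n (limit-unique (limit-zero fp≡0) (reach p pp p∣n))

  prime-image-below : ∀ n p → 1 ≤ n → 1 ≤ f n → Prime p → p ∣ n → 1 ≤ f p × f p < n
  prime-image-below n p 1≤n 1≤fn pp p∣n =
    1≤fp , <-≤-trans (f-decreasing p (prime>1 pp)) (∣⇒≤ {{>-nonZero 1≤n}} p∣n)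
    where
    1≤fp : 1 ≤ f p
    1≤fp with f p | image-divides n 1≤n p pp p∣n
    ... | zero  | 0∣fn = ⊥-elim (<-irrefl (sym (0∣⇒≡0 0∣fn)) 1≤fn)
    ... | suc _ | _    = s≤s z≤n

  Characterisation : ℕ → Set
  Characterisation n = 1 ≤ n → HasLimit f n 1 ⇔ PrimeDivisorsReach1 n

  -- Passing from n to f n ≠ 0 preserves the condition, given the
  -- characterisation below n: a prime q ∣ f n is a prime divisor p of n or
  -- divides f p < n; conversely q ∣ n gives f q ∣ f n with f q < n.
  reach1-image : ∀ n → 1 ≤ n → 1 ≤ f n → (∀ {m} → m < n → Characterisation m)
    → PrimeDivisorsReach1 (f n) ⇔ PrimeDivisorsReach1 n
  reach1-image n 1≤n 1≤fn below = mk⇔ to from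
    where
    at-image : ∀ {p} → Prime p → p ∣ n → HasLimit f (f p) 1 ⇔ PrimeDivisorsReach1 (f p)
    at-image {p} pp p∣n with prime-image-below n p 1≤n 1≤fn pp p∣n
    ... | 1≤fp , fp<n = below fp<n 1≤fp
    to : PrimeDivisorsReach1 (f n) → PrimeDivisorsReach1 n
    to reach q qp q∣n = Equivalence.to limit-shift
      (Equivalence.from (at-image qp q∣n) (reach1-∣ (image-divides n 1≤n q qp q∣n) reach))
    from : PrimeDivisorsReach1 n → PrimeDivisorsReach1 (f n)
    from reach q qp q∣fn with image-prime-divisor n 1≤n q qp q∣fn
    ... | p , pp , p∣n , inj₁ refl = reach p pp p∣n
    ... | p , pp , p∣n , inj₂ q∣fp =
      Equivalence.to (at-image pp p∣n) (Equivalence.from limit-shift (reach p pp p∣n)) q qp q∣fp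

  -- One step of the strong induction: n = 1 is trivial, f n = 0 makes both
  -- sides false, and otherwise H(n) = H(f n) with f n < n.
  characterisation-step : ∀ n → (∀ {m} → m < n → Characterisation m) → Characterisation n
  characterisation-step (suc zero) _ _ =
    mk⇔ (λ _ q qp q∣1 → ⊥-elim (prime∤1 qp q∣1)) (λ _ → fixed-point-limit f1≡1)
  characterisation-step n@(suc (suc _)) below 1≤n with f n ≟ 0
  ... | yes fn≡0 =
    let ¬lim , ¬reach = zero-image n 1≤n fn≡0 in mk⇔ (⊥-elim ∘ ¬lim) (⊥-elim ∘ ¬reach)
  ... | no fn≢0 =
    ⇔.trans (⇔.sym limit-shift)
      (⇔.trans (below (f-decreasing n (s≤s (s≤s z≤n))) 1≤fn) (reach1-image n 1≤n 1≤fn below))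
    where
    1≤fn : 1 ≤ f n
    1≤fn = n≢0⇒n>0 fn≢0

  characterisation : ∀ n → Characterisation n
  characterisation = <-rec Characterisation characterisation-step

  -- Since H(q) ∈ {0, 1}, the condition says exactly that no prime q ∈ Q divides k.
  inS⇔reach1 : ∀ k → InS f k ⇔ PrimeDivisorsReach1 k
  inS⇔reach1 k = mk⇔ to from
    where
    to : InS f k → PrimeDivisorsReach1 k
    to inS q qp q∣k with limit-exists f0≡0 f1≡1 f-decreasing q
    ... | inj₁ lim0 = ⊥-elim (inS q (qp , lim0) q∣k)
    ... | inj₂ lim1 = lim1
    from : PrimeDivisorsReach1 k → InS f k
    from reach q (qp , lim0) q∣k = 0≢1+n (limit-unique lim0 (reach q qp q∣k))

corollary1p2 : (f : ℕ → ℕ) → Multiplicative f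
    → (∀ p α → Prime p → 1 ≤ α → f (p ^ α) < p ^ α)
    → (∀ p α → Prime p → 1 ≤ α → f p ∣ f (p ^ α))
    → (∀ p α q → Prime p → 1 ≤ α → Prime q → q ∣ f (p ^ α) → q ∣ p * f p)
    → f 0 ≡ 0
    → ∀ k → 1 ≤ k → (HasLimit f k 1 ⇔ InS f k)
corollary1p2 f multiplicative I II III f0≡0 k 1≤k =
  ⇔.trans (characterisation k 1≤k) (⇔.sym (inS⇔reach1 k))
  where open Conditions f multiplicative I II III f0≡0
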